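{- Consider the following two rewriting rules on finite simple directed graphs. Sequential flow: if $b$ is the only successor of $a$ and $a$ is the only predecessor of $b$, merge $a$ and $b$. Parallel flow: if $a\neq b$ have the same set of predecessors and the same set of successors, merge $a$ and $b$. This rewriting system is confluent: for every finite simple digraph $G$, any two graphs obtained from $G$ by finite sequences of rule applications can be further reduced by rule applications to a common graph. In particular, applying the rules in any order until no rule is applicable yields a unique reduced graph.
   Context: Merging two vertices $a,b$ of $G=(V,E)$ replaces them by a single new vertex $v_{ab}$ (which records the merged set of original vertices), whose predecessors are the predecessors of $a$ or $b$ other than $a,b$, and whose successors are the successors of $a$ or $b$ other than $a,b$; all other arcs are unchanged and no loops are created. Graphs resulting from different sequences are compared by identifying vertices corresponding to the same sets of original vertices. -}

module Defs where

open import Data.Bool using (Bool; true; false; _∧_; _∨_; not; if_then_else_)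
open import Data.Bool.Properties renaming (_≟_ to _≟ᵇ_)
open import Data.Nat using (ℕ; zero; suc; _≡ᵇ_)
open import Data.Fin using (Fin; zero; suc)
open import Data.Fin.Subset using (Subset; _∪_; ∣_∣)
open import Data.Vec using (lookup)
open import Data.Vec.Properties using (≡-dec)
open import Data.Product using (Σ; ∃; ∃₂; _×_; _,_)
open import Relation.Nullary using (¬_; Dec; yes; no)
open import Relation.Nullary.Decidable using (⌊_⌋)
open import Relation.Binary.PropositionalEquality using (_≡_)
open import Relation.Binary.Construct.Closure.ReflexiveTransitive using (Star)
open import Function.Bundles using (_⇔_)

-- Vertices are named by the set of original vertices they record (a Subset n);
-- V S = true iff S is (the label of) a vertex, E S T = true iff there is an arc S → T.
-- Only the values of E on pairs of vertices are meaningful (see Arc, _≈_).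
record Graph (n : ℕ) : Set where
  field
    V : Subset n → Bool
    E : Subset n → Subset n → Bool
open Graph public

_≟ˢ_ : ∀ {n} (S T : Subset n) → Dec (S ≡ T)
_≟ˢ_ = ≡-dec _≟ᵇ_

_==_ : ∀ {n} (S T : Subset n) → Bool
S == T = ⌊ S ≟ˢ T ⌋

IsV : ∀ {n} → Graph n → Subset n → Set
IsV G S = V G S ≡ true

Arc : ∀ {n} → Graph n → Subset n → Subset n → Set
Arc G S T = IsV G S × IsV G T × E G S T ≡ true

_≈_ : ∀ {n} → Graph n → Graph n → Set
G ≈ H = (∀ S → V G S ≡ V H S) × (∀ S T → Arc G S T ⇔ Arc H S T)

anyFin : ∀ {n} → (Fin n → Bool) → Bool
anyFin {zero}  f = false
anyFin {suc n} f = f zero ∨ anyFin (λ i → f (suc i))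

initial : ∀ {n} → (Fin n → Fin n → Bool) → Graph n
initial {n} adj = record
  { V = λ S → ∣ S ∣ ≡ᵇ 1
  ; E = λ S T → anyFin (λ i → anyFin (λ j → lookup S i ∧ lookup T j ∧ adj i j))
  }

merge : ∀ {n} → Subset n → Subset n → Graph n → Graph n
merge {n} a b G = record { V = V' ; E = E' }
  where
  ab = a ∪ b
  V' : Subset n → Bool
  V' S = if S == ab then true else (if (S == a) ∨ (S == b) then false else V G S)
  tgt : Subset n → Subset n → Bool
  tgt X T = if T == ab then (E G X a ∨ E G X b) else E G X T
  E' : Subset n → Subset n → Bool
  E' S T = not (S == T) ∧ (if S == ab then (tgt a T ∨ tgt b T) else tgt S T)

SeqFlow : ∀ {n} → Graph n → Subset n → Subset n → Set
SeqFlow G a b = IsV G a × IsV G b × Arc G a b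
  × (∀ X → Arc G a X → X ≡ b) × (∀ X → Arc G X b → X ≡ a)

ParFlow : ∀ {n} → Graph n → Subset n → Subset n → Set
ParFlow G a b = IsV G a × IsV G b × ¬ (a ≡ b)
  × (∀ X → Arc G X a ⇔ Arc G X b) × (∀ X → Arc G a X ⇔ Arc G b X)

data Step {n : ℕ} (G : Graph n) : Graph n → Set where
  seq : ∀ a b → SeqFlow G a b → Step G (merge a b G)
  par : ∀ a b → ParFlow G a b → Step G (merge a b G)

_⇒*_ : ∀ {n} → Graph n → Graph n → Set
_⇒*_ = Star Step

Normal : ∀ {n} → Graph n → Set
Normal G = ¬ (∃ λ H → Step G H)

-- Call a graph well formed when its vertices are disjoint nonempty sets of original vertices
-- and its arcs are exactly the pairs of distinct vertices containing adjacent original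
-- vertices. The initial graph is well formed (the digraph has no loops) and both rules
-- preserve this, so a reachable graph is determined by its vertex set. At a well-formed
-- graph two rule applications can be completed by at most one step each to graphs with the
-- same vertices: rules on disjoint pairs commute, a sequential and a parallel pair never
-- overlap, and overlapping pairs of the same kind (a chain a → b → c, or a ∥ b together with
-- a ∥ c) both end by merging the three vertices. Steps transfer along equality of vertex
-- sets, so the strip lemma yields confluence modulo that equality; normal forms admit no
-- further step, hence reachable normal forms agree.

module Submission where

open import Defs
open import Data.Bool using (Bool; true; false; _∧_; _∨_)
open import Data.Bool.Properties using (T-≡)
open import Data.Nat using (ℕ)
open import Data.Nat.Properties using (≡ᵇ⇒≡; suc-injective)
open import Data.Fin using (Fin; zero; suc)
open import Data.Fin.Subset using (Subset; _∪_; _∈_; _⊆_; Nonempty; ∣_∣; ⁅_⁆; inside; outside)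
  renaming (⊥ to ∅)
open import Data.Fin.Subset.Properties
  using (∪-comm; ∪-assoc; x∈p∪q⁻; p⊆p∪q; q⊆p∪q; x∈⁅x⁆; x∈⁅y⁆⇒x≡y)
open import Data.Vec using ([]; _∷_; lookup)
open import Data.Vec.Properties using (lookup⇒[]=; []=⇒lookup)
open import Data.Product using (∃; ∃₂; _×_; _,_; proj₁; proj₂)
open import Data.Sum as Sum using (_⊎_; inj₁; inj₂)
open import Function using (id; _∘_)
open import Function.Bundles using (_⇔_; mk⇔; Equivalence)
open import Relation.Nullary using (¬_; yes; no; contradiction)
open import Relation.Binary.Structures using (IsEquivalence)
open import Relation.Binary.PropositionalEquality
open import Relation.Binary.Construct.Closure.Reflexive using (ReflClosure; [_]) renaming (refl to stay)
open import Relation.Binary.Construct.Closure.ReflexiveTransitive using (Star; ε; _◅_; _◅◅_)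

open Equivalence using (to; from)

private variable
  n : ℕ

JoinableModulo : {A : Set} → (A → A → Set) → (A → A → Set) → A → A → Set
JoinableModulo _∼_ R y z = ∃₂ λ y′ z′ → R y y′ × R z z′ × y′ ∼ z′

module StrongConfluence
  {A : Set} {_⟶_ : A → A → Set} {_∼_ : A → A → Set} (∼-isEquivalence : IsEquivalence _∼_)
  (Good : A → Set)
  (good-step : ∀ {x y} → Good x → x ⟶ y → Good y)
  (simulate : ∀ {x x′ y} → Good x → Good x′ → x ∼ x′ → x ⟶ y → ∃ λ y′ → x′ ⟶ y′ × y ∼ y′)
  (strong-diamond : ∀ {x y z} → Good x → x ⟶ y → x ⟶ z → JoinableModulo _∼_ (ReflClosure _⟶_) y z)
  where

  private
    module ∼ = IsEquivalence ∼-isEquivalence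

    _⟶*_ : A → A → Set
    _⟶*_ = Star _⟶_

    at-most-one : ∀ {x y} → ReflClosure _⟶_ x y → x ⟶* y
    at-most-one stay  = ε
    at-most-one [ s ] = s ◅ ε

  good-star : ∀ {x y} → Good x → x ⟶* y → Good y
  good-star g ε       = g
  good-star g (s ◅ r) = good-star (good-step g s) r

  simulate-star : ∀ {x x′ y} → Good x → Good x′ → x ∼ x′ → x ⟶* y →
                  ∃ λ y′ → x′ ⟶* y′ × y ∼ y′
  simulate-star g g′ e ε = _ , ε , e
  simulate-star g g′ e (s ◅ r) with simulate g g′ e s
  ... | _ , s′ , e′ with simulate-star (good-step g s) (good-step g′ s′) e′ r
  ...   | y′ , r′ , e″ = y′ , s′ ◅ r′ , e″

  strip : ∀ {x y z} → Good x → x ⟶ y → x ⟶* z → JoinableModulo _∼_ _⟶*_ y z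
  strip g s ε = _ , _ , ε , s ◅ ε , ∼.refl
  strip g s (s′ ◅ r) with strong-diamond g s s′
  ... | _ , _ , o , stay , e
    with simulate-star (good-step g s′) (good-star (good-step g s) (at-most-one o)) (∼.sym e) r
  ...   | z′ , r′ , e′ = z′ , _ , at-most-one o ◅◅ r′ , ε , ∼.sym e′
  strip g s (s′ ◅ r) | _ , _ , o , [ s″ ] , e with strip (good-step g s′) s″ r
  ... | L₁ , L₂ , r₁ , r₂ , e₂
    with simulate-star (good-step (good-step g s′) s″) (good-star (good-step g s) (at-most-one o)) (∼.sym e) r₁
  ...   | L₁′ , r₁′ , e₃ = L₁′ , L₂ , at-most-one o ◅◅ r₁′ , r₂ , ∼.trans (∼.sym e₃) e₂

  confluent : ∀ {x y z} → Good x → x ⟶* y → x ⟶* z → JoinableModulo _∼_ _⟶*_ y z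
  confluent g ε q = _ , _ , q , ε , ∼.refl
  confluent g (s ◅ r) q with strip g s q
  ... | _ , _ , q₁ , q₂ , e with confluent (good-step g s) r q₁
  ... | L₁ , _ , r₁ , r₂ , e₂
    with simulate-star (good-star (good-step g s) q₁) (good-star (good-star g q) q₂) e r₂
  ...   | L₂′ , r₂′ , e₃ = L₁ , L₂′ , r₁ , q₂ ◅◅ r₂′ , ∼.trans e₂ e₃

∨≡true⁻ : ∀ x {y} → x ∨ y ≡ true → x ≡ true ⊎ y ≡ true
∨≡true⁻ true  _ = inj₁ refl
∨≡true⁻ false p = inj₂ p

∨≡true⁺ : ∀ {x y} → x ≡ true ⊎ y ≡ true → x ∨ y ≡ true
∨≡true⁺ (inj₁ refl)      = refl
∨≡true⁺ {true}  (inj₂ _) = refl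
∨≡true⁺ {false} (inj₂ p) = p

∧≡true⁻ : ∀ x {y} → x ∧ y ≡ true → x ≡ true × y ≡ true
∧≡true⁻ true p = refl , p

∧≡true⁺ : ∀ {x y} → x ≡ true → y ≡ true → x ∧ y ≡ true
∧≡true⁺ refl refl = refl

≡true-ext : ∀ {x y} → (x ≡ true ⇔ y ≡ true) → x ≡ y
≡true-ext {true}          x⇔y = sym (to x⇔y refl)
≡true-ext {false} {true}  x⇔y = from x⇔y refl
≡true-ext {false} {false} x⇔y = refl

==-refl : (S : Subset n) → S == S ≡ true
==-refl S with S ≟ˢ S
... | yes _  = refl
... | no S≢S = contradiction refl S≢S

≢⇒==false : {S T : Subset n} → S ≢ T → S == T ≡ false
≢⇒==false {S = S} {T} S≢T with S ≟ˢ T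
... | yes S≡T = contradiction S≡T S≢T
... | no _    = refl

anyFin⁻ : ∀ {n} (f : Fin n → Bool) → anyFin f ≡ true → ∃ λ i → f i ≡ true
anyFin⁻ {ℕ.suc _} f e with ∨≡true⁻ (f zero) e
... | inj₁ f₀ = zero , f₀
... | inj₂ rest = let (i , fᵢ) = anyFin⁻ (f ∘ suc) rest in suc i , fᵢ

anyFin⁺ : ∀ {n} (f : Fin n → Bool) i → f i ≡ true → anyFin f ≡ true
anyFin⁺ f zero    fᵢ = ∨≡true⁺ (inj₁ fᵢ)
anyFin⁺ f (suc i) fᵢ = ∨≡true⁺ {f zero} (inj₂ (anyFin⁺ (f ∘ suc) i fᵢ))

∣p∣≡0⇒p≡∅ : ∀ (p : Subset n) → ∣ p ∣ ≡ 0 → p ≡ ∅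
∣p∣≡0⇒p≡∅ []            _     = refl
∣p∣≡0⇒p≡∅ (outside ∷ p) |p|≡0 = cong (outside ∷_) (∣p∣≡0⇒p≡∅ p |p|≡0)

∣p∣≡1⇒p≡⁅x⁆ : ∀ (p : Subset n) → ∣ p ∣ ≡ 1 → ∃ λ i → p ≡ ⁅ i ⁆
∣p∣≡1⇒p≡⁅x⁆ (inside ∷ p)  |p|≡1 = zero , cong (inside ∷_) (∣p∣≡0⇒p≡∅ p (suc-injective |p|≡1))
∣p∣≡1⇒p≡⁅x⁆ (outside ∷ p) |p|≡1 =
  let (i , p≡⁅i⁆) = ∣p∣≡1⇒p≡⁅x⁆ p |p|≡1 in suc i , cong (outside ∷_) p≡⁅i⁆

-- V (merge a b G) S unfolds to a conditional from which Agda cannot infer a, b, G or S: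
-- hence the explicit arguments below, and a record for _≈ⱽ_.
module MergeFacts (a b : Subset n) (G : Graph n) where

  merge-V⁻ : ∀ S → IsV (merge a b G) S → S ≡ a ∪ b ⊎ (IsV G S × S ≢ a × S ≢ b)
  merge-V⁻ S v with S ≟ˢ (a ∪ b) | S ≟ˢ a | S ≟ˢ b
  ... | yes S≡ab | _ | _ = inj₁ S≡ab
  ... | no _ | no S≢a | no S≢b = inj₂ (v , S≢a , S≢b)
  merge-V⁻ S () | no _ | yes _ | _
  merge-V⁻ S () | no _ | no _  | yes _

  merge-V-∪ : IsV (merge a b G) (a ∪ b)
  merge-V-∪ rewrite ==-refl (a ∪ b) = refl

  merge-V-old : ∀ S → IsV G S → S ≢ a → S ≢ b → IsV (merge a b G) S
  merge-V-old S v S≢a S≢b with S ≟ˢ (a ∪ b)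
  ... | yes _ = refl
  ... | no _ rewrite ≢⇒==false S≢a | ≢⇒==false S≢b = v

  merge-V⁺ : ∀ S → S ≡ a ∪ b ⊎ (IsV G S × S ≢ a × S ≢ b) → IsV (merge a b G) S
  merge-V⁺ S (inj₁ refl)            = merge-V-∪
  merge-V⁺ S (inj₂ (v , S≢a , S≢b)) = merge-V-old S v S≢a S≢b

  merge-E-irrefl : ∀ S → E (merge a b G) S S ≡ false
  merge-E-irrefl S rewrite ==-refl S = refl

  merge-E-old : ∀ S T → S ≢ T → S ≢ a ∪ b → T ≢ a ∪ b → E (merge a b G) S T ≡ E G S T
  merge-E-old S T S≢T S≢ab T≢ab rewrite ≢⇒==false S≢T | ≢⇒==false S≢ab | ≢⇒==false T≢ab = refl

  merge-E-from∪ : ∀ T → T ≢ a ∪ b → E (merge a b G) (a ∪ b) T ≡ E G a T ∨ E G b T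
  merge-E-from∪ T T≢ab rewrite ≢⇒==false (≢-sym T≢ab) | ==-refl (a ∪ b) | ≢⇒==false T≢ab = refl

  merge-E-to∪ : ∀ S → S ≢ a ∪ b → E (merge a b G) S (a ∪ b) ≡ E G S a ∨ E G S b
  merge-E-to∪ S S≢ab rewrite ≢⇒==false S≢ab | ==-refl (a ∪ b) = refl

record _≈ⱽ_ (G H : Graph n) : Set where
  constructor mk≈ⱽ
  field same-V : ∀ S → V G S ≡ V H S
open _≈ⱽ_

≈ⱽ-isEquivalence : IsEquivalence (_≈ⱽ_ {n})
≈ⱽ-isEquivalence = record
  { refl  = mk≈ⱽ λ _ → refl
  ; sym   = λ G≈H → mk≈ⱽ λ S → sym (same-V G≈H S)
  ; trans = λ G≈H H≈K → mk≈ⱽ λ S → trans (same-V G≈H S) (same-V H≈K S)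
  }

module ≈ⱽ {n} = IsEquivalence (≈ⱽ-isEquivalence {n})

≈ⱽ-from⇔ : {G H : Graph n} → (∀ S → IsV G S ⇔ IsV H S) → G ≈ⱽ H
≈ⱽ-from⇔ G⇔H = mk≈ⱽ λ S → ≡true-ext (G⇔H S)

≈ⱽ-transport : {G H : Graph n} → G ≈ⱽ H → ∀ {S} → IsV G S → IsV H S
≈ⱽ-transport G≈H {S} v = trans (sym (same-V G≈H S)) v

open MergeFacts

merge-cong : (a b : Subset n) {G H : Graph n} → G ≈ⱽ H → merge a b G ≈ⱽ merge a b H
merge-cong a b G≈H = ≈ⱽ-from⇔ λ S → mk⇔ (transport G≈H S) (transport (≈ⱽ.sym G≈H) S)
  where
  transport : ∀ {G H} → G ≈ⱽ H → ∀ S → IsV (merge a b G) S → IsV (merge a b H) S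
  transport {G} {H} G≈H S v = merge-V⁺ a b H S
    (Sum.map₂ (λ (vS , S≢a , S≢b) → ≈ⱽ-transport G≈H vS , S≢a , S≢b) (merge-V⁻ a b G S v))

merge-comm : (a b : Subset n) (G : Graph n) → merge a b G ≈ⱽ merge b a G
merge-comm a b G = ≈ⱽ-from⇔ λ S → mk⇔ (swap a b S) (swap b a S)
  where
  swap : ∀ a b S → IsV (merge a b G) S → IsV (merge b a G) S
  swap a b S v with merge-V⁻ a b G S v
  ... | inj₁ refl rewrite ∪-comm a b = merge-V-∪ b a G
  ... | inj₂ (vS , S≢a , S≢b) = merge-V-old b a G S vS S≢b S≢a

data Rule (G : Graph n) (a b : Subset n) : Set where
  sequential : SeqFlow G a b → Rule G a b
  parallel   : ParFlow G a b → Rule G a b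

rule-step : ∀ {G : Graph n} {a b} → Rule G a b → Step G (merge a b G)
rule-step (sequential s) = seq _ _ s
rule-step (parallel p)   = par _ _ p

parFlow-sym : ∀ {G : Graph n} {a b} → ParFlow G a b → ParFlow G b a
parFlow-sym (va , vb , a≢b , preds , succs) =
  vb , va , ≢-sym a≢b , (λ X → mk⇔ (from (preds X)) (to (preds X))) , (λ X → mk⇔ (from (succs X)) (to (succs X)))

parFlow-avoids-seqFlow : ∀ {G : Graph n} {a b x y} → SeqFlow G a b → ParFlow G x y → x ≢ a × x ≢ b
parFlow-avoids-seqFlow {b = b} (_ , _ , ab , succ-a , pred-b) (_ , _ , x≢y , preds , succs) =
  (λ { refl → x≢y (sym (pred-b _ (to (succs b) ab))) }) ,
  (λ { refl → x≢y (sym (succ-a _ (to (preds _) ab))) })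

seqFlow-same-source : ∀ {G : Graph n} {a b d} → SeqFlow G a b → SeqFlow G a d → b ≡ d
seqFlow-same-source (_ , _ , _ , succ-a , _) (_ , _ , ad , _) = sym (succ-a _ ad)

seqFlow-same-target : ∀ {G : Graph n} {a b c} → SeqFlow G a b → SeqFlow G c b → a ≡ c
seqFlow-same-target (_ , _ , _ , _ , pred-b) (_ , _ , cb , _) = sym (pred-b _ cb)

Apart : Subset n → Subset n → Subset n → Subset n → Set
Apart a b c d = c ≢ a × c ≢ b × d ≢ a × d ≢ b

seqFlow-parFlow-apart : ∀ {G : Graph n} {a b c d} → SeqFlow G a b → ParFlow G c d → Apart a b c d
seqFlow-parFlow-apart s p with parFlow-avoids-seqFlow s p | parFlow-avoids-seqFlow s (parFlow-sym p)
... | c≢a , c≢b | d≢a , d≢b = c≢a , c≢b , d≢a , d≢b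

module Contraction (adj : Fin n → Fin n → Bool) where

  Adj : Subset n → Subset n → Set
  Adj S T = ∃₂ λ i j → i ∈ S × j ∈ T × adj i j ≡ true

  Adj-mono : ∀ {S S′ T T′} → S ⊆ S′ → T ⊆ T′ → Adj S T → Adj S′ T′
  Adj-mono S⊆S′ T⊆T′ (i , j , i∈S , j∈T , aᵢⱼ) = i , j , S⊆S′ i∈S , T⊆T′ j∈T , aᵢⱼ

  Adj-∪ˡ⁻ : ∀ a b {T} → Adj (a ∪ b) T → Adj a T ⊎ Adj b T
  Adj-∪ˡ⁻ a b (i , j , i∈ab , j∈T , aᵢⱼ) =
    Sum.map (λ i∈a → i , j , i∈a , j∈T , aᵢⱼ) (λ i∈b → i , j , i∈b , j∈T , aᵢⱼ) (x∈p∪q⁻ a b i∈ab)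

  Adj-∪ʳ⁻ : ∀ a b {S} → Adj S (a ∪ b) → Adj S a ⊎ Adj S b
  Adj-∪ʳ⁻ a b (i , j , i∈S , j∈ab , aᵢⱼ) =
    Sum.map (λ j∈a → i , j , i∈S , j∈a , aᵢⱼ) (λ j∈b → i , j , i∈S , j∈b , aᵢⱼ) (x∈p∪q⁻ a b j∈ab)

  record WellFormed (G : Graph n) : Set where
    field
      nonempty : ∀ S → IsV G S → Nonempty S
      disjoint : ∀ S T {i} → IsV G S → IsV G T → i ∈ S → i ∈ T → S ≡ T
      arc⇒adj  : ∀ S T → Arc G S T → S ≢ T × Adj S T
      adj⇒arc  : ∀ S T → IsV G S → IsV G T → S ≢ T → Adj S T → E G S T ≡ true

    arc⁺ : ∀ S T → IsV G S → IsV G T → S ≢ T → Adj S T → Arc G S T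
    arc⁺ S T vS vT S≢T st = vS , vT , adj⇒arc S T vS vT S≢T st

    no-loop : ∀ S → ¬ Arc G S S
    no-loop S x = proj₁ (arc⇒adj S S x) refl

  open WellFormed

  arc-transport : ∀ {G H : Graph n} → WellFormed G → WellFormed H → G ≈ⱽ H → ∀ {S T} → Arc G S T → Arc H S T
  arc-transport wfG wfH G≈H {S} {T} x@(vS , vT , _) with arc⇒adj wfG S T x
  ... | S≢T , st = arc⁺ wfH S T (≈ⱽ-transport G≈H vS) (≈ⱽ-transport G≈H vT) S≢T st

  ≈ⱽ⇒≈ : ∀ {G H : Graph n} → WellFormed G → WellFormed H → G ≈ⱽ H → G ≈ H
  ≈ⱽ⇒≈ wfG wfH G≈H =
    same-V G≈H , λ S T → mk⇔ (arc-transport wfG wfH G≈H) (arc-transport wfH wfG (≈ⱽ.sym G≈H))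

  module _ {G H : Graph n} (wfG : WellFormed G) (wfH : WellFormed H) (G≈H : G ≈ⱽ H) where

    private
      there : ∀ {S T} → Arc G S T → Arc H S T
      there = arc-transport wfG wfH G≈H

      back : ∀ {S T} → Arc H S T → Arc G S T
      back = arc-transport wfH wfG (≈ⱽ.sym G≈H)

    seqFlow-transport : ∀ {a b} → SeqFlow G a b → SeqFlow H a b
    seqFlow-transport (va , vb , ab , succ-a , pred-b) =
      ≈ⱽ-transport G≈H va , ≈ⱽ-transport G≈H vb , there ab ,
      (λ X → succ-a X ∘ back) , (λ X → pred-b X ∘ back)

    parFlow-transport : ∀ {a b} → ParFlow G a b → ParFlow H a b
    parFlow-transport (va , vb , a≢b , preds , succs) =
      ≈ⱽ-transport G≈H va , ≈ⱽ-transport G≈H vb , a≢b ,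
      (λ X → mk⇔ (there ∘ to (preds X) ∘ back) (there ∘ from (preds X) ∘ back)) ,
      (λ X → mk⇔ (there ∘ to (succs X) ∘ back) (there ∘ from (succs X) ∘ back))

  step-transport : ∀ {G G′ H : Graph n} → WellFormed G → WellFormed G′ → G ≈ⱽ G′ →
                   Step G H → ∃ λ H′ → Step G′ H′ × H ≈ⱽ H′
  step-transport wf wf′ G≈G′ (seq a b s) = _ , seq a b (seqFlow-transport wf wf′ G≈G′ s) , merge-cong a b G≈G′
  step-transport wf wf′ G≈G′ (par a b p) = _ , par a b (parFlow-transport wf wf′ G≈G′ p) , merge-cong a b G≈G′

  module Merging {G : Graph n} (wf : WellFormed G) {a b : Subset n}
                 (va : IsV G a) (vb : IsV G b) (a≢b : a ≢ b) where

    private module M = MergeFacts a b G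

    Untouched : Subset n → Set
    Untouched S = IsV G S × S ≢ a × S ≢ b

    ∪-fresh : ¬ IsV G (a ∪ b)
    ∪-fresh v with nonempty wf a va | nonempty wf b vb
    ... | i , i∈a | j , j∈b =
      a≢b (trans (disjoint wf a (a ∪ b) va v i∈a (p⊆p∪q b i∈a))
                 (sym (disjoint wf b (a ∪ b) vb v j∈b (q⊆p∪q a b j∈b))))

    vertex≢∪ : ∀ {S} → IsV G S → S ≢ a ∪ b
    vertex≢∪ v refl = ∪-fresh v

    ∪-apart : ∀ {S i} → Untouched S → i ∈ a ∪ b → ¬ i ∈ S
    ∪-apart {S} (vS , S≢a , S≢b) i∈ab i∈S with x∈p∪q⁻ a b i∈ab
    ... | inj₁ i∈a = S≢a (disjoint wf S a vS va i∈S i∈a)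
    ... | inj₂ i∈b = S≢b (disjoint wf S b vS vb i∈S i∈b)

    merge-arc⇒adj : ∀ S T → Arc (merge a b G) S T → S ≢ T × Adj S T
    merge-arc⇒adj S T (vS , vT , e) = S≢T , adjacent (M.merge-V⁻ S vS) (M.merge-V⁻ T vT)
      where
      S≢T : S ≢ T
      S≢T refl = contradiction (trans (sym e) (M.merge-E-irrefl S)) λ ()
      old-adj : ∀ {X Y} → IsV G X → IsV G Y → E G X Y ≡ true → Adj X Y
      old-adj vX vY eXY = proj₂ (arc⇒adj wf _ _ (vX , vY , eXY))
      adjacent : S ≡ a ∪ b ⊎ Untouched S → T ≡ a ∪ b ⊎ Untouched T → Adj S T
      adjacent (inj₁ refl) (inj₁ refl) = contradiction refl S≢T
      adjacent (inj₁ refl) (inj₂ (vT′ , _))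
        with ∨≡true⁻ (E G a T) (trans (sym (M.merge-E-from∪ T (vertex≢∪ vT′))) e)
      ... | inj₁ aT = Adj-mono (p⊆p∪q b) id (old-adj va vT′ aT)
      ... | inj₂ bT = Adj-mono (q⊆p∪q a b) id (old-adj vb vT′ bT)
      adjacent (inj₂ (vS′ , _)) (inj₁ refl)
        with ∨≡true⁻ (E G S a) (trans (sym (M.merge-E-to∪ S (vertex≢∪ vS′))) e)
      ... | inj₁ Sa = Adj-mono id (p⊆p∪q b) (old-adj vS′ va Sa)
      ... | inj₂ Sb = Adj-mono id (q⊆p∪q a b) (old-adj vS′ vb Sb)
      adjacent (inj₂ (vS′ , _)) (inj₂ (vT′ , _)) =
        old-adj vS′ vT′ (trans (sym (M.merge-E-old S T S≢T (vertex≢∪ vS′) (vertex≢∪ vT′))) e)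

    merge-adj⇒arc : ∀ S T → IsV (merge a b G) S → IsV (merge a b G) T → S ≢ T → Adj S T →
                    E (merge a b G) S T ≡ true
    merge-adj⇒arc S T vS vT S≢T st = arc-E (M.merge-V⁻ S vS) (M.merge-V⁻ T vT)
      where
      arc-E : S ≡ a ∪ b ⊎ Untouched S → T ≡ a ∪ b ⊎ Untouched T → E (merge a b G) S T ≡ true
      arc-E (inj₁ refl) (inj₁ refl) = contradiction refl S≢T
      arc-E (inj₁ refl) (inj₂ (vT′ , T≢a , T≢b)) = trans (M.merge-E-from∪ T (vertex≢∪ vT′))
        (∨≡true⁺ (Sum.map (adj⇒arc wf a T va vT′ (≢-sym T≢a)) (adj⇒arc wf b T vb vT′ (≢-sym T≢b))
                          (Adj-∪ˡ⁻ a b st)))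
      arc-E (inj₂ (vS′ , S≢a , S≢b)) (inj₁ refl) = trans (M.merge-E-to∪ S (vertex≢∪ vS′))
        (∨≡true⁺ (Sum.map (adj⇒arc wf S a vS′ va S≢a) (adj⇒arc wf S b vS′ vb S≢b)
                          (Adj-∪ʳ⁻ a b st)))
      arc-E (inj₂ (vS′ , _)) (inj₂ (vT′ , _)) =
        trans (M.merge-E-old S T S≢T (vertex≢∪ vS′) (vertex≢∪ vT′)) (adj⇒arc wf S T vS′ vT′ S≢T st)

    merge-wf : WellFormed (merge a b G)
    nonempty merge-wf S v with M.merge-V⁻ S v
    ... | inj₁ refl = let (i , i∈a) = nonempty wf a va in i , p⊆p∪q b i∈a
    ... | inj₂ (vS , _) = nonempty wf S vS
    disjoint merge-wf S T vS vT i∈S i∈T with M.merge-V⁻ S vS | M.merge-V⁻ T vT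
    ... | inj₁ S≡ab | inj₁ T≡ab = trans S≡ab (sym T≡ab)
    ... | inj₁ refl | inj₂ uT = contradiction i∈T (∪-apart uT i∈S)
    ... | inj₂ uS | inj₁ refl = contradiction i∈S (∪-apart uS i∈T)
    ... | inj₂ (vS′ , _) | inj₂ (vT′ , _) = disjoint wf S T vS′ vT′ i∈S i∈T
    arc⇒adj merge-wf = merge-arc⇒adj
    adj⇒arc merge-wf = merge-adj⇒arc

    -- S′ ↦ S : the vertex S′ of G is part of the vertex S of the merged graph.
    infix 4 _↦_
    data _↦_ (S′ : Subset n) : Subset n → Set where
      merged : S′ ≡ a ⊎ S′ ≡ b → S′ ↦ a ∪ b
      kept   : Untouched S′ → S′ ↦ S′

    untouched-unmerged : ∀ {S} → Untouched S → ¬ (S ≡ a ⊎ S ≡ b)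
    untouched-unmerged (_ , S≢a , _) (inj₁ S≡a) = S≢a S≡a
    untouched-unmerged (_ , _ , S≢b) (inj₂ S≡b) = S≢b S≡b

    ↦-source : ∀ {S′ S} → S′ ↦ S → IsV G S′
    ↦-source (merged (inj₁ refl)) = va
    ↦-source (merged (inj₂ refl)) = vb
    ↦-source (kept (vS′ , _))     = vS′

    ↦-target : ∀ {S′ S} → S′ ↦ S → IsV (merge a b G) S
    ↦-target     (merged _)                = M.merge-V-∪
    ↦-target {S′} (kept (vS′ , S′≢a , S′≢b)) = M.merge-V-old S′ vS′ S′≢a S′≢b

    ↦-⊆ : ∀ {S′ S} → S′ ↦ S → S′ ⊆ S
    ↦-⊆ (merged (inj₁ refl)) = p⊆p∪q b
    ↦-⊆ (merged (inj₂ refl)) = q⊆p∪q a b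
    ↦-⊆ (kept _)             = id

    ↦-cover : ∀ S {i} → IsV (merge a b G) S → i ∈ S → ∃ λ S′ → S′ ↦ S × i ∈ S′
    ↦-cover S v i∈S with M.merge-V⁻ S v
    ... | inj₂ uS = S , kept uS , i∈S
    ... | inj₁ refl with x∈p∪q⁻ a b i∈S
    ...   | inj₁ i∈a = a , merged (inj₁ refl) , i∈a
    ...   | inj₂ i∈b = b , merged (inj₂ refl) , i∈b

    ↦-functional : ∀ {S′ S T} → S′ ↦ S → S′ ↦ T → S ≡ T
    ↦-functional (merged _)  (merged _)  = refl
    ↦-functional (merged p)  (kept uS′)  = contradiction p (untouched-unmerged uS′)
    ↦-functional (kept uS′)  (merged p)  = contradiction p (untouched-unmerged uS′)
    ↦-functional (kept _)    (kept _)    = refl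

    ↦-∪ : ∀ {S′} → S′ ↦ a ∪ b → S′ ≡ a ⊎ S′ ≡ b
    ↦-∪ (merged p)        = p
    ↦-∪ (kept (vab , _)) = contradiction vab ∪-fresh

    merged-↦ : ∀ {S′ S} → S′ ≡ a ⊎ S′ ≡ b → S′ ↦ S → S ≡ a ∪ b
    merged-↦ _ (merged _)  = refl
    merged-↦ p (kept uS′) = contradiction p (untouched-unmerged uS′)

    untouched-↦ : ∀ {S′ S} → Untouched S′ → S′ ↦ S → S ≡ S′
    untouched-↦ uS′ (merged p) = contradiction p (untouched-unmerged uS′)
    untouched-↦ _   (kept _)   = refl

    ↦-untouched : ∀ {S′ S} → Untouched S → S′ ↦ S → S′ ≡ S
    ↦-untouched (vab , _) (merged _) = contradiction vab ∪-fresh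
    ↦-untouched _         (kept _)   = refl

    ↦-≢ : ∀ {S′ S T} → Untouched T → S′ ↦ S → S′ ≢ T → S ≢ T
    ↦-≢ uT S′↦S S′≢T refl = S′≢T (↦-untouched uT S′↦S)

    arc-merge⁻ : ∀ S T → Arc (merge a b G) S T → ∃₂ λ S′ T′ → S′ ↦ S × T′ ↦ T × Arc G S′ T′
    arc-merge⁻ S T x@(vS , vT , _) with arc⇒adj merge-wf S T x
    ... | S≢T , i , j , i∈S , j∈T , aᵢⱼ with ↦-cover S vS i∈S | ↦-cover T vT j∈T
    ... | S′ , S′↦S , i∈S′ | T′ , T′↦T , j∈T′ =
      S′ , T′ , S′↦S , T′↦T ,
      arc⁺ wf S′ T′ (↦-source S′↦S) (↦-source T′↦T) (λ { refl → S≢T (↦-functional S′↦S T′↦T) })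
        (i , j , i∈S′ , j∈T′ , aᵢⱼ)

    arc-merge⁺ : ∀ {S′ T′ S T} → S′ ↦ S → T′ ↦ T → S ≢ T → Arc G S′ T′ → Arc (merge a b G) S T
    arc-merge⁺ {S′} {T′} {S} {T} S′↦S T′↦T S≢T x =
      arc⁺ merge-wf S T (↦-target S′↦S) (↦-target T′↦T) S≢T
        (Adj-mono (↦-⊆ S′↦S) (↦-⊆ T′↦T) (proj₂ (arc⇒adj wf S′ T′ x)))

    arc-into-untouched⁻ : ∀ S T → Untouched T → Arc (merge a b G) S T → ∃ λ S′ → S′ ↦ S × Arc G S′ T
    arc-into-untouched⁻ S T uT x with arc-merge⁻ S T x
    ... | S′ , T′ , S′↦S , T′↦T , x′ with ↦-untouched uT T′↦T
    ... | refl = S′ , S′↦S , x′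

    arc-from-untouched⁻ : ∀ S T → Untouched S → Arc (merge a b G) S T → ∃ λ T′ → T′ ↦ T × Arc G S T′
    arc-from-untouched⁻ S T uS x with arc-merge⁻ S T x
    ... | S′ , T′ , S′↦S , T′↦T , x′ with ↦-untouched uS S′↦S
    ... | refl = T′ , T′↦T , x′

    arc-into-untouched⁺ : ∀ {S′ S T} → Untouched T → S′ ↦ S → Arc G S′ T → Arc (merge a b G) S T
    arc-into-untouched⁺ {S′} {T = T} uT S′↦S x =
      arc-merge⁺ S′↦S (kept uT) (↦-≢ uT S′↦S (proj₁ (arc⇒adj wf S′ T x))) x

    arc-from-untouched⁺ : ∀ {S T′ T} → Untouched S → T′ ↦ T → Arc G S T′ → Arc (merge a b G) S T
    arc-from-untouched⁺ {S} {T′} uS T′↦T x =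
      arc-merge⁺ (kept uS) T′↦T (≢-sym (↦-≢ uS T′↦T (≢-sym (proj₁ (arc⇒adj wf S T′ x))))) x

    preds-⊆-persist : ∀ {c d} → Untouched c → Untouched d → (∀ Y → Arc G Y c → Arc G Y d) →
                      ∀ X → Arc (merge a b G) X c → Arc (merge a b G) X d
    preds-⊆-persist {c} uc ud c⊆d X x with arc-into-untouched⁻ X c uc x
    ... | X′ , X′↦X , x′ = arc-into-untouched⁺ ud X′↦X (c⊆d X′ x′)

    succs-⊆-persist : ∀ {c d} → Untouched c → Untouched d → (∀ Y → Arc G c Y → Arc G d Y) →
                      ∀ X → Arc (merge a b G) c X → Arc (merge a b G) d X
    succs-⊆-persist {c} uc ud c⊆d X x with arc-from-untouched⁻ c X uc x
    ... | X′ , X′↦X , x′ = arc-from-untouched⁺ ud X′↦X (c⊆d X′ x′)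

    unique-succ-persists : ∀ {c d} → Untouched c → Untouched d → (∀ Y → Arc G c Y → Y ≡ d) →
                           ∀ X → Arc (merge a b G) c X → X ≡ d
    unique-succ-persists {c} uc ud succ-c X x with arc-from-untouched⁻ c X uc x
    ... | X′ , X′↦X , x′ with succ-c X′ x′
    ... | refl = untouched-↦ ud X′↦X

    unique-pred-persists : ∀ {c d} → Untouched c → Untouched d → (∀ Y → Arc G Y d → Y ≡ c) →
                           ∀ X → Arc (merge a b G) X d → X ≡ c
    unique-pred-persists {d = d} uc ud pred-d X x with arc-into-untouched⁻ X d ud x
    ... | X′ , X′↦X , x′ with pred-d X′ x′
    ... | refl = untouched-↦ uc X′↦X

    rule-persists : ∀ {c d} → Untouched c → Untouched d → Rule G c d → Rule (merge a b G) c d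
    rule-persists uc ud (sequential (_ , _ , cd , succ-c , pred-d)) = sequential
      ( ↦-target (kept uc) , ↦-target (kept ud) , arc-into-untouched⁺ ud (kept uc) cd
      , unique-succ-persists uc ud succ-c , unique-pred-persists uc ud pred-d )
    rule-persists uc ud (parallel (_ , _ , c≢d , preds , succs)) = parallel
      ( ↦-target (kept uc) , ↦-target (kept ud) , c≢d
      , (λ X → mk⇔ (preds-⊆-persist uc ud (to ∘ preds) X) (preds-⊆-persist ud uc (from ∘ preds) X))
      , (λ X → mk⇔ (succs-⊆-persist uc ud (to ∘ succs) X) (succs-⊆-persist ud uc (from ∘ succs) X)) )

    preds-merge-third : ∀ {z} → Untouched z →
                        (∀ X → Arc G X a ⇔ Arc G X b) → (∀ X → Arc G X a ⇔ Arc G X z) →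
                        ∀ X → Arc (merge a b G) X (a ∪ b) ⇔ Arc (merge a b G) X z
    preds-merge-third {z} uz preds-ab preds-az X = mk⇔ into-∪⇒into-z into-z⇒into-∪
      where
      into-z : ∀ {Y A} → A ≡ a ⊎ A ≡ b → Arc G Y A → Arc G Y z
      into-z (inj₁ refl) = to (preds-az _)
      into-z (inj₂ refl) = to (preds-az _) ∘ from (preds-ab _)
      no-arc-into-a : ∀ {A} → A ≡ a ⊎ A ≡ b → ¬ Arc G A a
      no-arc-into-a (inj₁ refl) = no-loop wf a
      no-arc-into-a (inj₂ refl) = no-loop wf b ∘ to (preds-ab b)
      into-∪⇒into-z : Arc (merge a b G) X (a ∪ b) → Arc (merge a b G) X z
      into-∪⇒into-z x with arc-merge⁻ X (a ∪ b) x
      ... | X′ , A , X′↦X , A↦ab , x′ = arc-into-untouched⁺ uz X′↦X (into-z (↦-∪ A↦ab) x′)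
      into-z⇒into-∪ : Arc (merge a b G) X z → Arc (merge a b G) X (a ∪ b)
      into-z⇒into-∪ x with arc-into-untouched⁻ X z uz x
      ... | X′ , X′↦X , x′ = arc-merge⁺ X′↦X (merged (inj₁ refl))
        (λ { refl → no-arc-into-a (↦-∪ X′↦X) (from (preds-az X′) x′) }) (from (preds-az X′) x′)

    succs-merge-third : ∀ {z} → Untouched z →
                        (∀ X → Arc G a X ⇔ Arc G b X) → (∀ X → Arc G a X ⇔ Arc G z X) →
                        ∀ X → Arc (merge a b G) (a ∪ b) X ⇔ Arc (merge a b G) z X
    succs-merge-third {z} uz succs-ab succs-az X = mk⇔ from-∪⇒from-z from-z⇒from-∪
      where
      from-z : ∀ {Y A} → A ≡ a ⊎ A ≡ b → Arc G A Y → Arc G z Y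
      from-z (inj₁ refl) = to (succs-az _)
      from-z (inj₂ refl) = to (succs-az _) ∘ from (succs-ab _)
      no-arc-from-a : ∀ {A} → A ≡ a ⊎ A ≡ b → ¬ Arc G a A
      no-arc-from-a (inj₁ refl) = no-loop wf a
      no-arc-from-a (inj₂ refl) = no-loop wf b ∘ to (succs-ab b)
      from-∪⇒from-z : Arc (merge a b G) (a ∪ b) X → Arc (merge a b G) z X
      from-∪⇒from-z x with arc-merge⁻ (a ∪ b) X x
      ... | A , X′ , A↦ab , X′↦X , x′ = arc-from-untouched⁺ uz X′↦X (from-z (↦-∪ A↦ab) x′)
      from-z⇒from-∪ : Arc (merge a b G) z X → Arc (merge a b G) (a ∪ b) X
      from-z⇒from-∪ x with arc-from-untouched⁻ z X uz x
      ... | X′ , X′↦X , x′ = arc-merge⁺ (merged (inj₁ refl)) X′↦X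
        (λ { refl → no-arc-from-a (↦-∪ X′↦X) (from (succs-az X′) x′) }) (from (succs-az X′) x′)

    parFlow-merge-third : ∀ {z} → ParFlow G a b → ParFlow G a z → b ≢ z → ParFlow (merge a b G) (a ∪ b) z
    parFlow-merge-third {z} (_ , _ , _ , preds-ab , succs-ab) (_ , vz , a≢z , preds-az , succs-az) b≢z =
      M.merge-V-∪ , ↦-target (kept uz) , ≢-sym (vertex≢∪ vz) ,
      preds-merge-third uz preds-ab preds-az , succs-merge-third uz succs-ab succs-az
      where
      uz : Untouched z
      uz = vz , ≢-sym a≢z , ≢-sym b≢z

    seqFlow-merge-next : ∀ {c} → SeqFlow G a b → SeqFlow G b c → a ≢ c → SeqFlow (merge a b G) (a ∪ b) c
    seqFlow-merge-next {c} (_ , _ , _ , succ-a , _) (_ , vc , bc , succ-b , pred-c) a≢c =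
      M.merge-V-∪ , ↦-target (kept uc) , arc-into-untouched⁺ uc (merged (inj₂ refl)) bc , succ-∪ , pred-c′
      where
      uc : Untouched c
      uc = vc , ≢-sym a≢c , ≢-sym (proj₁ (arc⇒adj wf b c bc))
      successor : ∀ {A X′ X} → A ≡ a ⊎ A ≡ b → X′ ↦ X → Arc G A X′ →
                  Arc (merge a b G) (a ∪ b) X → X ≡ c
      successor (inj₁ refl) X′↦X x′ x with succ-a _ x′
      ... | refl with merged-↦ (inj₂ refl) X′↦X
      ...   | refl = contradiction x (no-loop merge-wf (a ∪ b))
      successor (inj₂ refl) X′↦X x′ _ with succ-b _ x′
      ... | refl = untouched-↦ uc X′↦X
      succ-∪ : ∀ X → Arc (merge a b G) (a ∪ b) X → X ≡ c
      succ-∪ X x with arc-merge⁻ (a ∪ b) X x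
      ... | A , X′ , A↦ab , X′↦X , x′ = successor (↦-∪ A↦ab) X′↦X x′ x
      pred-c′ : ∀ X → Arc (merge a b G) X c → X ≡ a ∪ b
      pred-c′ X x with arc-into-untouched⁻ X c uc x
      ... | X′ , X′↦X , x′ = merged-↦ (inj₂ (pred-c X′ x′)) X′↦X

    seqFlow-merge-prev : ∀ {z} → SeqFlow G z a → SeqFlow G a b → z ≢ b → SeqFlow (merge a b G) z (a ∪ b)
    seqFlow-merge-prev {z} (vz , _ , za , succ-z , pred-a) (_ , _ , _ , _ , pred-b) z≢b =
      ↦-target (kept uz) , M.merge-V-∪ , arc-from-untouched⁺ uz (merged (inj₁ refl)) za , succ-z′ , pred-∪
      where
      uz : Untouched z
      uz = vz , proj₁ (arc⇒adj wf z a za) , z≢b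
      predecessor : ∀ {A X′ X} → A ≡ a ⊎ A ≡ b → X′ ↦ X → Arc G X′ A →
                    Arc (merge a b G) X (a ∪ b) → X ≡ z
      predecessor (inj₁ refl) X′↦X x′ _ with pred-a _ x′
      ... | refl = untouched-↦ uz X′↦X
      predecessor (inj₂ refl) X′↦X x′ x with pred-b _ x′
      ... | refl with merged-↦ (inj₁ refl) X′↦X
      ...   | refl = contradiction x (no-loop merge-wf (a ∪ b))
      succ-z′ : ∀ X → Arc (merge a b G) z X → X ≡ a ∪ b
      succ-z′ X x with arc-from-untouched⁻ z X uz x
      ... | X′ , X′↦X , x′ = merged-↦ (inj₁ (succ-z X′ x′)) X′↦X
      pred-∪ : ∀ X → Arc (merge a b G) X (a ∪ b) → X ≡ z
      pred-∪ X x with arc-merge⁻ X (a ∪ b) x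
      ... | X′ , A , X′↦X , A↦ab , x′ = predecessor (↦-∪ A↦ab) X′↦X x′ x

    merge³-V⇔ : ∀ c S → IsV (merge (a ∪ b) c (merge a b G)) S ⇔ (S ≡ (a ∪ b) ∪ c ⊎ (Untouched S × S ≢ c))
    merge³-V⇔ c S = mk⇔ split join
      where
      module M′ = MergeFacts (a ∪ b) c (merge a b G)
      split : IsV (merge (a ∪ b) c (merge a b G)) S → S ≡ (a ∪ b) ∪ c ⊎ (Untouched S × S ≢ c)
      split v with M′.merge-V⁻ S v
      ... | inj₁ S≡abc = inj₁ S≡abc
      ... | inj₂ (v′ , S≢ab , S≢c) with M.merge-V⁻ S v′
      ...   | inj₁ S≡ab = contradiction S≡ab S≢ab
      ...   | inj₂ uS   = inj₂ (uS , S≢c)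
      join : S ≡ (a ∪ b) ∪ c ⊎ (Untouched S × S ≢ c) → IsV (merge (a ∪ b) c (merge a b G)) S
      join (inj₁ refl)       = M′.merge-V-∪
      join (inj₂ (uS , S≢c)) = M′.merge-V-old S (↦-target (kept uS)) (vertex≢∪ (proj₁ uS)) S≢c

    merge²-V⇔ : ∀ {c d} → IsV G c → IsV G d → ∀ S →
                IsV (merge c d (merge a b G)) S ⇔ (S ≡ c ∪ d ⊎ S ≡ a ∪ b ⊎ (Untouched S × S ≢ c × S ≢ d))
    merge²-V⇔ {c} {d} vc vd S = mk⇔ split join
      where
      module M′ = MergeFacts c d (merge a b G)
      split : IsV (merge c d (merge a b G)) S → S ≡ c ∪ d ⊎ S ≡ a ∪ b ⊎ (Untouched S × S ≢ c × S ≢ d)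
      split v with M′.merge-V⁻ S v
      ... | inj₁ S≡cd = inj₁ S≡cd
      ... | inj₂ (v′ , S≢c , S≢d) = inj₂ (Sum.map₂ (λ uS → uS , S≢c , S≢d) (M.merge-V⁻ S v′))
      join : S ≡ c ∪ d ⊎ S ≡ a ∪ b ⊎ (Untouched S × S ≢ c × S ≢ d) → IsV (merge c d (merge a b G)) S
      join (inj₁ refl)               = M′.merge-V-∪
      join (inj₂ (inj₁ refl))        =
        M′.merge-V-old (a ∪ b) M.merge-V-∪ (≢-sym (vertex≢∪ vc)) (≢-sym (vertex≢∪ vd))
      join (inj₂ (inj₂ (uS , S≢c , S≢d))) = M′.merge-V-old S (↦-target (kept uS)) S≢c S≢d

  rule-distinct : ∀ {G : Graph n} {a b} → WellFormed G → Rule G a b → IsV G a × IsV G b × a ≢ b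
  rule-distinct wf (sequential (va , vb , ab , _)) = va , vb , proj₁ (arc⇒adj wf _ _ ab)
  rule-distinct wf (parallel (va , vb , a≢b , _))  = va , vb , a≢b

  rule-wf : ∀ {G : Graph n} {a b} → WellFormed G → Rule G a b → WellFormed (merge a b G)
  rule-wf wf r = let (va , vb , a≢b) = rule-distinct wf r in Merging.merge-wf wf va vb a≢b

  step-wf : ∀ {G H : Graph n} → WellFormed G → Step G H → WellFormed H
  step-wf wf (seq _ _ s) = rule-wf wf (sequential s)
  step-wf wf (par _ _ p) = rule-wf wf (parallel p)

  Joinable⁼ : Graph n → Graph n → Set
  Joinable⁼ = JoinableModulo _≈ⱽ_ (ReflClosure Step)

  joinable-refl : ∀ {G : Graph n} → Joinable⁼ G G
  joinable-refl = _ , _ , stay , stay , ≈ⱽ.refl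

  joinable-sym : ∀ {G H : Graph n} → Joinable⁼ G H → Joinable⁼ H G
  joinable-sym (K₁ , K₂ , o₁ , o₂ , K₁≈K₂) = K₂ , K₁ , o₂ , o₁ , ≈ⱽ.sym K₁≈K₂

  joinable-respˡ : ∀ {G G′ H : Graph n} → WellFormed G → WellFormed G′ → G ≈ⱽ G′ →
                   Joinable⁼ G′ H → Joinable⁼ G H
  joinable-respˡ wf wf′ G≈G′ (_ , K₂ , stay , o₂ , K₁≈K₂) = _ , K₂ , stay , o₂ , ≈ⱽ.trans G≈G′ K₁≈K₂
  joinable-respˡ wf wf′ G≈G′ (_ , K₂ , [ s ] , o₂ , K₁≈K₂) with step-transport wf′ wf (≈ⱽ.sym G≈G′) s
  ... | K₁′ , s′ , K₁≈K₁′ = K₁′ , K₂ , [ s′ ] , o₂ , ≈ⱽ.trans (≈ⱽ.sym K₁≈K₁′) K₁≈K₂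

  joinable-flipˡ : ∀ {G H : Graph n} {a b} → WellFormed G → ParFlow G a b →
                   Joinable⁼ (merge b a G) H → Joinable⁼ (merge a b G) H
  joinable-flipˡ {G = G} {a = a} {b} wf p =
    joinable-respˡ (rule-wf wf (parallel p)) (rule-wf wf (parallel (parFlow-sym p))) (merge-comm a b G)

  joinable-flipʳ : ∀ {G H : Graph n} {a b} → WellFormed G → ParFlow G a b →
                   Joinable⁼ H (merge b a G) → Joinable⁼ H (merge a b G)
  joinable-flipʳ wf p = joinable-sym ∘ joinable-flipˡ wf p ∘ joinable-sym

  disjoint-joinable : ∀ {G : Graph n} {a b c d} → WellFormed G → Rule G a b → Rule G c d → Apart a b c d →
                      Joinable⁼ (merge a b G) (merge c d G)
  disjoint-joinable {G = G} wf r₁ r₂ (c≢a , c≢b , d≢a , d≢b)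
    with rule-distinct wf r₁ | rule-distinct wf r₂
  ... | va , vb , a≢b | vc , vd , c≢d =
    _ , _ ,
    [ rule-step (AB.rule-persists (vc , c≢a , c≢b) (vd , d≢a , d≢b) r₂) ] ,
    [ rule-step (CD.rule-persists (va , ≢-sym c≢a , ≢-sym d≢a) (vb , ≢-sym c≢b , ≢-sym d≢b) r₁) ] ,
    ≈ⱽ-from⇔ λ S → mk⇔ (from (CD.merge²-V⇔ va vb S) ∘ swap ∘ to (AB.merge²-V⇔ vc vd S))
                        (from (AB.merge²-V⇔ vc vd S) ∘ swap ∘ to (CD.merge²-V⇔ va vb S))
    where
    module AB = Merging wf va vb a≢b
    module CD = Merging wf vc vd c≢d
    swap : ∀ {a b c d S} →
      S ≡ c ∪ d ⊎ S ≡ a ∪ b ⊎ ((IsV G S × S ≢ a × S ≢ b) × S ≢ c × S ≢ d) →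
      S ≡ a ∪ b ⊎ S ≡ c ∪ d ⊎ ((IsV G S × S ≢ c × S ≢ d) × S ≢ a × S ≢ b)
    swap (inj₁ S≡cd)        = inj₂ (inj₁ S≡cd)
    swap (inj₂ (inj₁ S≡ab)) = inj₁ S≡ab
    swap (inj₂ (inj₂ ((vS , S≢a , S≢b) , S≢c , S≢d))) = inj₂ (inj₂ ((vS , S≢c , S≢d) , S≢a , S≢b))

  seq-chain-joinable : ∀ {G : Graph n} {a b c} → WellFormed G → SeqFlow G a b → SeqFlow G b c → a ≢ c →
                       Joinable⁼ (merge a b G) (merge b c G)
  seq-chain-joinable {G = G} {a} {b} {c} wf s@(va , vb , ab , _) t@(_ , vc , bc , _) a≢c =
    _ , _ , [ seq _ _ (AB.seqFlow-merge-next s t a≢c) ] , [ seq _ _ (BC.seqFlow-merge-prev s t a≢c) ] ,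
    ≈ⱽ.trans (≈ⱽ-from⇔ λ S → mk⇔ (from (BC.merge³-V⇔ a S) ∘ rotate ∘ to (AB.merge³-V⇔ c S))
                                  (from (AB.merge³-V⇔ c S) ∘ unrotate ∘ to (BC.merge³-V⇔ a S)))
             (merge-comm (b ∪ c) a (merge b c G))
    where
    module AB = Merging wf va vb (proj₁ (arc⇒adj wf a b ab))
    module BC = Merging wf vb vc (proj₁ (arc⇒adj wf b c bc))
    abc≡bca : (a ∪ b) ∪ c ≡ (b ∪ c) ∪ a
    abc≡bca = trans (∪-assoc a b c) (∪-comm a (b ∪ c))
    rotate : ∀ {S} → S ≡ (a ∪ b) ∪ c ⊎ ((IsV G S × S ≢ a × S ≢ b) × S ≢ c) →
                     S ≡ (b ∪ c) ∪ a ⊎ ((IsV G S × S ≢ b × S ≢ c) × S ≢ a)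
    rotate (inj₁ S≡abc) = inj₁ (trans S≡abc abc≡bca)
    rotate (inj₂ ((vS , S≢a , S≢b) , S≢c)) = inj₂ ((vS , S≢b , S≢c) , S≢a)
    unrotate : ∀ {S} → S ≡ (b ∪ c) ∪ a ⊎ ((IsV G S × S ≢ b × S ≢ c) × S ≢ a) →
                       S ≡ (a ∪ b) ∪ c ⊎ ((IsV G S × S ≢ a × S ≢ b) × S ≢ c)
    unrotate (inj₁ S≡bca) = inj₁ (trans S≡bca (sym abc≡bca))
    unrotate (inj₂ ((vS , S≢b , S≢c) , S≢a)) = inj₂ ((vS , S≢a , S≢b) , S≢c)

  par-common-joinable : ∀ {G : Graph n} {x y z} → WellFormed G → ParFlow G x y → ParFlow G x z → y ≢ z →
                        Joinable⁼ (merge x y G) (merge x z G)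
  par-common-joinable {G = G} {x} {y} {z} wf p@(vx , vy , x≢y , _) q@(_ , vz , x≢z , _) y≢z =
    _ , _ , [ par _ _ (XY.parFlow-merge-third p q y≢z) ] , [ par _ _ (XZ.parFlow-merge-third q p (≢-sym y≢z)) ] ,
    ≈ⱽ-from⇔ λ S → mk⇔ (from (XZ.merge³-V⇔ y S) ∘ exchange y z ∘ to (XY.merge³-V⇔ z S))
                        (from (XY.merge³-V⇔ z S) ∘ exchange z y ∘ to (XZ.merge³-V⇔ y S))
    where
    module XY = Merging wf vx vy x≢y
    module XZ = Merging wf vx vz x≢z
    exchange : ∀ y z {S} → S ≡ (x ∪ y) ∪ z ⊎ ((IsV G S × S ≢ x × S ≢ y) × S ≢ z) →
                           S ≡ (x ∪ z) ∪ y ⊎ ((IsV G S × S ≢ x × S ≢ z) × S ≢ y)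
    exchange y z (inj₁ S≡xyz) =
      inj₁ (trans S≡xyz (trans (∪-assoc x y z) (trans (cong (x ∪_) (∪-comm y z)) (sym (∪-assoc x z y)))))
    exchange y z (inj₂ ((vS , S≢x , S≢y) , S≢z)) = inj₂ ((vS , S≢x , S≢z) , S≢y)

  seq-seq-joinable : ∀ {G : Graph n} {a b c d} → WellFormed G → SeqFlow G a b → SeqFlow G c d →
                     Joinable⁼ (merge a b G) (merge c d G)
  seq-seq-joinable {G = G} {a} {b} {c} {d} wf s t with a ≟ˢ c | b ≟ˢ d | b ≟ˢ c | a ≟ˢ d
  ... | yes refl | _ | _ | _ rewrite seqFlow-same-source s t = joinable-refl
  ... | no _ | yes refl | _ | _ rewrite seqFlow-same-target s t = joinable-refl
  ... | no _ | no _ | yes refl | yes refl = _ , _ , stay , stay , merge-comm a b G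
  ... | no _ | no _ | yes refl | no a≢d = seq-chain-joinable wf s t a≢d
  ... | no _ | no _ | no b≢c | yes refl = joinable-sym (seq-chain-joinable wf t s (≢-sym b≢c))
  ... | no a≢c | no b≢d | no b≢c | no a≢d =
    disjoint-joinable wf (sequential s) (sequential t) (≢-sym a≢c , ≢-sym b≢c , ≢-sym a≢d , ≢-sym b≢d)

  par-par-joinable : ∀ {G : Graph n} {a b c d} → WellFormed G → ParFlow G a b → ParFlow G c d →
                     Joinable⁼ (merge a b G) (merge c d G)
  par-par-joinable {G = G} {a} {b} {c} {d} wf p q with a ≟ˢ c | b ≟ˢ d | b ≟ˢ c | a ≟ˢ d
  ... | yes refl | yes refl | _ | _ = joinable-refl
  ... | yes refl | no b≢d | _ | _ = par-common-joinable wf p q b≢d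
  ... | no a≢c | yes refl | _ | _ =
    joinable-flipˡ wf p (joinable-flipʳ wf q (par-common-joinable wf (parFlow-sym p) (parFlow-sym q) a≢c))
  ... | no _ | no _ | yes refl | yes refl = _ , _ , stay , stay , merge-comm a b G
  ... | no _ | no _ | yes refl | no a≢d = joinable-flipˡ wf p (par-common-joinable wf (parFlow-sym p) q a≢d)
  ... | no _ | no _ | no b≢c | yes refl = joinable-flipʳ wf q (par-common-joinable wf p (parFlow-sym q) b≢c)
  ... | no a≢c | no b≢d | no b≢c | no a≢d =
    disjoint-joinable wf (parallel p) (parallel q) (≢-sym a≢c , ≢-sym b≢c , ≢-sym a≢d , ≢-sym b≢d)

  step-diamond : ∀ {G H₁ H₂ : Graph n} → WellFormed G → Step G H₁ → Step G H₂ → Joinable⁼ H₁ H₂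
  step-diamond wf (seq _ _ s) (seq _ _ t) = seq-seq-joinable wf s t
  step-diamond wf (par _ _ p) (par _ _ q) = par-par-joinable wf p q
  step-diamond wf (seq _ _ s) (par _ _ p) =
    disjoint-joinable wf (sequential s) (parallel p) (seqFlow-parFlow-apart s p)
  step-diamond wf (par _ _ p) (seq _ _ s) =
    joinable-sym (disjoint-joinable wf (sequential s) (parallel p) (seqFlow-parFlow-apart s p))

  open StrongConfluence ≈ⱽ-isEquivalence WellFormed step-wf step-transport step-diamond
    using (good-star; confluent) public

  initial-singleton : ∀ S → IsV (initial adj) S → ∃ λ i → S ≡ ⁅ i ⁆
  initial-singleton S v = ∣p∣≡1⇒p≡⁅x⁆ S (≡ᵇ⇒≡ ∣ S ∣ 1 (from T-≡ v))

  initial-E⇔Adj : ∀ S T → E (initial adj) S T ≡ true ⇔ Adj S T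
  initial-E⇔Adj S T = mk⇔ adjacent arc
    where
    adjacent : E (initial adj) S T ≡ true → Adj S T
    adjacent e with anyFin⁻ _ e
    ... | i , eᵢ with anyFin⁻ _ eᵢ
    ... | j , eᵢⱼ with ∧≡true⁻ (lookup S i) eᵢⱼ
    ... | Sᵢ , eⱼ with ∧≡true⁻ (lookup T j) eⱼ
    ... | Tⱼ , aᵢⱼ = i , j , lookup⇒[]= i S Sᵢ , lookup⇒[]= j T Tⱼ , aᵢⱼ
    arc : Adj S T → E (initial adj) S T ≡ true
    arc (i , j , i∈S , j∈T , aᵢⱼ) =
      anyFin⁺ _ i (anyFin⁺ _ j (∧≡true⁺ ([]=⇒lookup i∈S) (∧≡true⁺ ([]=⇒lookup j∈T) aᵢⱼ)))

  singleton-no-self-adj : (∀ i → adj i i ≡ false) → ∀ k → ¬ Adj ⁅ k ⁆ ⁅ k ⁆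
  singleton-no-self-adj irreflexive k (i , j , i∈⁅k⁆ , j∈⁅k⁆ , aᵢⱼ)
    with x∈⁅y⁆⇒x≡y k i∈⁅k⁆ | x∈⁅y⁆⇒x≡y k j∈⁅k⁆
  ... | refl | refl = contradiction (trans (sym aᵢⱼ) (irreflexive k)) λ ()

  initial-wf : (∀ i → adj i i ≡ false) → WellFormed (initial adj)
  nonempty (initial-wf _) S v with initial-singleton S v
  ... | i , refl = i , x∈⁅x⁆ i
  disjoint (initial-wf _) S T vS vT i∈S i∈T with initial-singleton S vS | initial-singleton T vT
  ... | j , refl | k , refl = cong ⁅_⁆ (trans (sym (x∈⁅y⁆⇒x≡y j i∈S)) (x∈⁅y⁆⇒x≡y k i∈T))
  arc⇒adj (initial-wf irreflexive) S T (vS , _ , e) with initial-singleton S vS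
  ... | k , refl = (λ { refl → singleton-no-self-adj irreflexive k st }) , st
    where
    st : Adj ⁅ k ⁆ T
    st = to (initial-E⇔Adj ⁅ k ⁆ T) e
  adj⇒arc (initial-wf _) S T _ _ _ = from (initial-E⇔Adj S T)

normal-star : ∀ {G H : Graph n} → Normal G → G ⇒* H → G ≡ H
normal-star normal ε       = refl
normal-star normal (s ◅ _) = contradiction (_ , s) normal

theorem2 : ∀ {n : ℕ} (adj : Fin n → Fin n → Bool) → (∀ i → adj i i ≡ false) →
    (∀ G₁ G₂ → initial adj ⇒* G₁ → initial adj ⇒* G₂ →
      ∃₂ λ H₁ H₂ → G₁ ⇒* H₁ × G₂ ⇒* H₂ × H₁ ≈ H₂)
    × (∀ G₁ G₂ → initial adj ⇒* G₁ → initial adj ⇒* G₂ →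
      Normal G₁ → Normal G₂ → G₁ ≈ G₂)
theorem2 adj irreflexive = joinable , normal-forms-agree
  where
  open Contraction adj
  wf₀ : WellFormed (initial adj)
  wf₀ = initial-wf irreflexive
  joinable : ∀ G₁ G₂ → initial adj ⇒* G₁ → initial adj ⇒* G₂ →
             ∃₂ λ H₁ H₂ → G₁ ⇒* H₁ × G₂ ⇒* H₂ × H₁ ≈ H₂
  joinable _ _ p q with confluent wf₀ p q
  ... | H₁ , H₂ , r₁ , r₂ , H₁≈H₂ =
    H₁ , H₂ , r₁ , r₂ , ≈ⱽ⇒≈ (good-star wf₀ (p ◅◅ r₁)) (good-star wf₀ (q ◅◅ r₂)) H₁≈H₂
  normal-forms-agree : ∀ G₁ G₂ → initial adj ⇒* G₁ → initial adj ⇒* G₂ →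
                       Normal G₁ → Normal G₂ → G₁ ≈ G₂
  normal-forms-agree _ _ p q normal₁ normal₂ with confluent wf₀ p q
  ... | _ , _ , r₁ , r₂ , H₁≈H₂ with normal-star normal₁ r₁ | normal-star normal₂ r₂
  ... | refl | refl = ≈ⱽ⇒≈ (good-star wf₀ p) (good-star wf₀ q) H₁≈H₂
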